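{- Let $A\in\mathsf{ASM}_n(2143,3412)$ have exactly three entries equal to $-1$, all lying in row $i$, and let $d$ be the column of the middle one of these three $-1$ entries. Then $A_{i-1,d}=1$ and $A_{i+1,d}=1$.
   Context: An alternating sign matrix (ASM) is a square matrix with entries in $\{0,1,-1\}$ such that every row and every column sums to $1$ and the nonzero entries of each row and each column alternate in sign. A permutation $\pi\in S_k$ is identified with the $k\times k$ matrix whose row $i$ has a $1$ in column $\pi(i)$ and $0$ elsewhere. An $n\times n$ ASM $A$ classically contains $\pi\in S_k$ if there are order-preserving injections $f,g:[k]\to[n]$ with $A_{f(i),g(\pi(i))}=1$ for all $i$; otherwise $A$ classically avoids $\pi$. $\mathsf{ASM}_n(2143,3412)$ is the set of $n\times n$ ASMs classically avoiding both $2143$ and $3412$. -}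

module Defs where

open import Data.Nat using (ℕ)
open import Data.Fin using (Fin; toℕ; _<_)
open import Data.Fin.Patterns using (0F; 1F; 2F; 3F)
open import Data.Integer using (ℤ; _+_; _*_; -_; 0ℤ; 1ℤ; -1ℤ)
open import Data.List using (List; []; _∷_; map; foldr; filter)
open import Data.List.Base using (allFin)
open import Data.Product using (Σ; _×_; ∃; ∃-syntax)
open import Data.Sum using (_⊎_)
open import Relation.Binary.PropositionalEquality using (_≡_; _≢_)
open import Relation.Nullary using (¬_)
open import Relation.Unary using (∁)
open import Data.Integer.Properties using (_≟_)
open import Relation.Nullary.Decidable using (¬?)

Matrix : ℕ → Set
Matrix n = Fin n → Fin n → ℤ

sumℤ : List ℤ → ℤ
sumℤ = foldr _+_ 0ℤ

row : ∀ {n} → Matrix n → Fin n → List ℤ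
row A i = map (A i) (allFin _)

col : ∀ {n} → Matrix n → Fin n → List ℤ
col A j = map (λ i → A i j) (allFin _)

nonzeros : List ℤ → List ℤ
nonzeros = filter (λ x → ¬? (x ≟ 0ℤ))

-- consecutive entries have opposite signs (entries are ±1 after filtering)
data Alternating : List ℤ → Set where
  alt-[] : Alternating []
  alt-[x] : ∀ x → Alternating (x ∷ [])
  alt-∷ : ∀ x y xs → x * y ≡ -1ℤ → Alternating (y ∷ xs) → Alternating (x ∷ y ∷ xs)

GoodLine : List ℤ → Set
GoodLine l = sumℤ l ≡ 1ℤ × Alternating (nonzeros l)

IsASM : ∀ {n} → Matrix n → Set
IsASM {n} A =
  (∀ i j → A i j ≡ 0ℤ ⊎ A i j ≡ 1ℤ ⊎ A i j ≡ -1ℤ)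
  × (∀ i → GoodLine (row A i))
  × (∀ j → GoodLine (col A j))

StrictlyIncreasing : ∀ {k n} → (Fin k → Fin n) → Set
StrictlyIncreasing f = ∀ a b → a < b → f a < f b

Contains : ∀ {n k} → Matrix n → (Fin k → Fin k) → Set
Contains {n} {k} A π =
  Σ (Fin k → Fin n) λ f → Σ (Fin k → Fin n) λ g →
    StrictlyIncreasing f × StrictlyIncreasing g × (∀ i → A (f i) (g (π i)) ≡ 1ℤ)

Avoids : ∀ {n k} → Matrix n → (Fin k → Fin k) → Set
Avoids A π = ¬ Contains A π

-- one-line notation, 0-indexed: 2143 ↦ (1,0,3,2), 3412 ↦ (2,3,0,1)
p2143 : Fin 4 → Fin 4
p2143 0F = 1F
p2143 1F = 0F
p2143 2F = 3F
p2143 3F = 2F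

p3412 : Fin 4 → Fin 4
p3412 0F = 2F
p3412 1F = 3F
p3412 2F = 0F
p3412 3F = 1F

InASM-2143-3412 : ∀ {n} → Matrix n → Set
InASM-2143-3412 A = IsASM A × Avoids A p2143 × Avoids A p3412

-- The -1 at (i, d) is the only -1 of column d, so column d has a 1 above row i
-- and a 1 below it; hence the rows i - 1 and i + 1 exist. Suppose A_{i-1,d} ≠ 1.
-- It is not -1 either, so it is 0 and the 1 of row i - 1 sits in a column x ≠ d.
-- The -1 entries at (i, c₁) and (i, c₃) each have a 1 to their left and right in
-- row i and below them in their column. If x < d, the 1 of column d above row i,
-- the 1 at (i - 1, x), the 1 right of c₃ and the 1 below c₃ form a 2143; if x > d,
-- the 1s at (i - 1, x), left of c₁ and below c₁ give a 3412 instead. Row i + 1 is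
-- handled in the same way, the roles of 2143 and 3412 being exchanged.
module Submission where

open import Defs
open import Data.Bool using (Bool; true; false)
open import Data.Empty using (⊥-elim)
open import Data.Fin using (Fin; toℕ; fromℕ<; inject₁; _<_; _≤_) renaming (zero to fzero; suc to fsuc)
open import Data.Fin.Patterns using (0F; 1F; 2F; 3F)
open import Data.Fin.Properties using (<-trans; <-cmp; <⇒≢; ≤∧≢⇒<; toℕ-inject₁; toℕ-fromℕ<; toℕ<n)
open import Data.Integer using (ℤ; 0ℤ; 1ℤ; -1ℤ; _+_)
open import Data.Integer.Properties using (_≟_; +-identityˡ; +-identityʳ; +-assoc; *-identityˡ)
open import Data.List using (List; []; _∷_; tabulate)
open import Data.List.Properties using (map-tabulate)
open import Data.List.Relation.Unary.All using (All; []; _∷_)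
open import Data.List.Relation.Unary.All.Properties using (tabulate⁺)
open import Data.Nat using (ℕ; suc)
import Data.Nat as ℕ
import Data.Nat.Properties as ℕ
open import Data.Product using (_×_; _,_; proj₁; ∃-syntax; Σ-syntax; map; map₁; map₂)
open import Data.Sum using (_⊎_; inj₁; inj₂)
open import Data.Unit using (⊤; tt)
open import Function using (_∘_; id; case_of_)
open import Relation.Binary.Definitions using (tri<; tri≈; tri>)
open import Relation.Binary.PropositionalEquality using (_≡_; _≢_; ≢-sym; refl; sym; trans; cong; subst)
open import Relation.Nullary using (yes; no)

Trit : ℤ → Set
Trit x = x ≡ 0ℤ ⊎ x ≡ 1ℤ ⊎ x ≡ -1ℤ

trit-one : ∀ {x} → Trit x → x ≢ 0ℤ → x ≢ -1ℤ → x ≡ 1ℤ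
trit-one (inj₁ x≡0)         x≢0 _    = ⊥-elim (x≢0 x≡0)
trit-one (inj₂ (inj₁ x≡1))  _   _    = x≡1
trit-one (inj₂ (inj₂ x≡-1)) _   x≢-1 = ⊥-elim (x≢-1 x≡-1)

one≢zero : ∀ {x y} → x ≡ 1ℤ → y ≡ 0ℤ → x ≢ y
one≢zero refl refl ()

bit : Bool → ℤ
bit false = 0ℤ
bit true  = 1ℤ

-- Walk s t l: the running sums of l start at bit s, stay in {0, 1} and end at bit t.
data Walk : Bool → Bool → List ℤ → Set where
  []   : ∀ {s} → Walk s s []
  stay : ∀ {s t x l} → x ≡ 0ℤ → Walk s t l → Walk s t (x ∷ l)
  up   : ∀ {t x l} → x ≡ 1ℤ → Walk true t l → Walk false t (x ∷ l)
  down : ∀ {t x l} → x ≡ -1ℤ → Walk false t l → Walk true t (x ∷ l)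

walk-sum : ∀ {s t l} → Walk s t l → bit s + sumℤ l ≡ bit t
walk-sum {s} []                      = +-identityʳ (bit s)
walk-sum {s} (stay {l = l} refl w)   = trans (cong (bit s +_) (+-identityˡ (sumℤ l))) (walk-sum w)
walk-sum     (up {l = l} refl w)     = trans (+-identityˡ (1ℤ + sumℤ l)) (walk-sum w)
walk-sum     (down {l = l} refl w)   = trans (sym (+-assoc 1ℤ -1ℤ (sumℤ l))) (walk-sum w)

walk-endpoints : ∀ {s t l} → Walk s t l → sumℤ l ≡ 1ℤ → s ≡ false × t ≡ true
walk-endpoints {s} {t} w sum≡1 = endpoints s t (trans (cong (bit s +_) (sym sum≡1)) (walk-sum w))
  where
  endpoints : ∀ s t → bit s + 1ℤ ≡ bit t → s ≡ false × t ≡ true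
  endpoints false true  _ = refl , refl
  endpoints false false ()
  endpoints true  false ()
  endpoints true  true  ()

-- The sign a walk in state s expects of the next nonzero entry.
Fits : Bool → List ℤ → Set
Fits _     []      = ⊤
Fits false (x ∷ _) = x ≢ -1ℤ
Fits true  (x ∷ _) = x ≡ -1ℤ

fitting-state : ∀ m → ∃[ s ] Fits s m
fitting-state []      = false , tt
fitting-state (x ∷ _) with x ≟ -1ℤ
... | yes x≡-1 = true , x≡-1
... | no x≢-1  = false , x≢-1

alternating-tail : ∀ {x m} → Alternating (x ∷ m) → Alternating m
alternating-tail (alt-[x] _)       = alt-[]
alternating-tail (alt-∷ _ _ _ _ a) = a

fits-after-one : ∀ {m} → Alternating (1ℤ ∷ m) → Fits true m
fits-after-one (alt-[x] _)         = tt
fits-after-one (alt-∷ _ y _ 1y≡-1 _) = trans (sym (*-identityˡ y)) 1y≡-1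

fits-after-minus-one : ∀ {m} → Alternating (-1ℤ ∷ m) → Fits false m
fits-after-minus-one (alt-[x] _)        = tt
fits-after-minus-one (alt-∷ _ _ _ () _) refl

walk-of-alternating : ∀ {s l} → All Trit l → Alternating (nonzeros l) → Fits s (nonzeros l) →
                      ∃[ t ] Walk s t l
walk-of-alternating []                                 _ _ = _ , []
walk-of-alternating (inj₁ refl ∷ ts)                   a f = map₂ (stay refl) (walk-of-alternating ts a f)
walk-of-alternating {false} (inj₂ (inj₁ refl) ∷ ts)    a _ =
  map₂ (up refl) (walk-of-alternating ts (alternating-tail a) (fits-after-one a))
walk-of-alternating {true}  (inj₂ (inj₁ refl) ∷ _)     _ ()
walk-of-alternating {true}  (inj₂ (inj₂ refl) ∷ ts)    a _ =
  map₂ (down refl) (walk-of-alternating ts (alternating-tail a) (fits-after-minus-one a))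
walk-of-alternating {false} (inj₂ (inj₂ refl) ∷ _)     _ f = case f refl of λ ()

good-line-walk : ∀ {l} → All Trit l → GoodLine l → Walk false true l
good-line-walk {l} ts (sum≡1 , alt) with fitting-state (nonzeros l)
... | s , f with walk-of-alternating ts alt f
... | t , w with walk-endpoints w sum≡1
... | refl , refl = w

walk-has-one : ∀ {n} (f : Fin n → ℤ) → Walk false true (tabulate f) → ∃[ k ] f k ≡ 1ℤ
walk-has-one {suc _} f (stay _ w) = map fsuc id (walk-has-one (f ∘ fsuc) w)
walk-has-one {suc _} f (up f0≡1 _) = fzero , f0≡1

one-before : ∀ {n t} (f : Fin n → ℤ) → Walk false t (tabulate f) →
             ∀ j → f j ≡ -1ℤ → ∃[ k ] k < j × f k ≡ 1ℤ
one-before {suc _} f (stay f0≡0 _) fzero    f0≡-1 = case trans (sym f0≡0) f0≡-1 of λ ()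
one-before {suc _} f (up f0≡1 _)   fzero    f0≡-1 = case trans (sym f0≡1) f0≡-1 of λ ()
one-before {suc _} f (stay _ w)    (fsuc j) fj≡-1 =
  map fsuc (map₁ ℕ.s<s) (one-before (f ∘ fsuc) w j fj≡-1)
one-before {suc _} f (up f0≡1 _)   (fsuc j) _     = fzero , ℕ.z<s , f0≡1

one-after : ∀ {n s} (f : Fin n → ℤ) → Walk s true (tabulate f) →
            ∀ j → f j ≡ -1ℤ → ∃[ k ] j < k × f k ≡ 1ℤ
one-after {suc _} f (stay f0≡0 _) fzero    f0≡-1 = case trans (sym f0≡0) f0≡-1 of λ ()
one-after {suc _} f (up f0≡1 _)   fzero    f0≡-1 = case trans (sym f0≡1) f0≡-1 of λ ()
one-after {suc _} f (down _ w)    fzero    _     = map fsuc (ℕ.z<s ,_) (walk-has-one (f ∘ fsuc) w)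
one-after {suc _} f (stay _ w)    (fsuc j) fj≡-1 = map fsuc (map₁ ℕ.s<s) (one-after (f ∘ fsuc) w j fj≡-1)
one-after {suc _} f (up _ w)      (fsuc j) fj≡-1 = map fsuc (map₁ ℕ.s<s) (one-after (f ∘ fsuc) w j fj≡-1)
one-after {suc _} f (down _ w)    (fsuc j) fj≡-1 = map fsuc (map₁ ℕ.s<s) (one-after (f ∘ fsuc) w j fj≡-1)

row-walk : ∀ {n} {A : Matrix n} → IsASM A → ∀ i → Walk false true (tabulate (A i))
row-walk {A = A} (trits , rows , _) i =
  good-line-walk (tabulate⁺ (trits i)) (subst GoodLine (map-tabulate id (A i)) (rows i))

col-walk : ∀ {n} {A : Matrix n} → IsASM A → ∀ j → Walk false true (tabulate (λ i → A i j))
col-walk {A = A} (trits , _ , cols) j =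
  good-line-walk (tabulate⁺ (λ i → trits i j)) (subst GoodLine (map-tabulate id (λ i → A i j)) (cols j))

record Cross {n} (A : Matrix n) (i c : Fin n) : Set where
  field
    left    : Fin n
    left<c  : left < c
    A-left  : A i left ≡ 1ℤ
    right   : Fin n
    c<right : c < right
    A-right : A i right ≡ 1ℤ
    above   : Fin n
    above<i : above < i
    A-above : A above c ≡ 1ℤ
    below   : Fin n
    i<below : i < below
    A-below : A below c ≡ 1ℤ

minus-one-cross : ∀ {n} {A : Matrix n} → IsASM A → ∀ {i c} → A i c ≡ -1ℤ → Cross A i c
minus-one-cross {A = A} asm {i} {c} Aic≡-1
  with one-before (A i) (row-walk asm i) c Aic≡-1
     | one-after (A i) (row-walk asm i) c Aic≡-1
     | one-before (λ r → A r c) (col-walk asm c) i Aic≡-1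
     | one-after (λ r → A r c) (col-walk asm c) i Aic≡-1
... | l , l<c , Al | r , c<r , Ar | a , a<i , Aa | b , i<b , Ab =
  record { left = l ; left<c = l<c ; A-left = Al ; right = r ; c<right = c<r ; A-right = Ar
         ; above = a ; above<i = a<i ; A-above = Aa ; below = b ; i<below = i<b ; A-below = Ab }

quadruple : ∀ {n} → Fin n → Fin n → Fin n → Fin n → Fin 4 → Fin n
quadruple x₀ _  _  _  0F = x₀
quadruple _  x₁ _  _  1F = x₁
quadruple _  _  x₂ _  2F = x₂
quadruple _  _  _  x₃ 3F = x₃

quadruple-increasing : ∀ {n} {x₀ x₁ x₂ x₃ : Fin n} → x₀ < x₁ → x₁ < x₂ → x₂ < x₃ →
                       StrictlyIncreasing (quadruple x₀ x₁ x₂ x₃)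
quadruple-increasing p q r 0F 1F _ = p
quadruple-increasing p q r 0F 2F _ = <-trans p q
quadruple-increasing p q r 0F 3F _ = <-trans p (<-trans q r)
quadruple-increasing p q r 1F 2F _ = q
quadruple-increasing p q r 1F 3F _ = <-trans q r
quadruple-increasing p q r 2F 3F _ = r
quadruple-increasing p q r 0F 0F ()
quadruple-increasing p q r 1F 0F ()
quadruple-increasing p q r 1F 1F (ℕ.s≤s ())
quadruple-increasing p q r 2F 0F ()
quadruple-increasing p q r 2F 1F (ℕ.s≤s ())
quadruple-increasing p q r 2F 2F (ℕ.s≤s (ℕ.s≤s ()))
quadruple-increasing p q r 3F 0F ()
quadruple-increasing p q r 3F 1F (ℕ.s≤s ())
quadruple-increasing p q r 3F 2F (ℕ.s≤s (ℕ.s≤s ()))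
quadruple-increasing p q r 3F 3F (ℕ.s≤s (ℕ.s≤s (ℕ.s≤s ())))

module _ {n} {A : Matrix n} {r₀ r₁ r₂ r₃ c₀ c₁ c₂ c₃ : Fin n}
         (r₀<r₁ : r₀ < r₁) (r₁<r₂ : r₁ < r₂) (r₂<r₃ : r₂ < r₃)
         (c₀<c₁ : c₀ < c₁) (c₁<c₂ : c₁ < c₂) (c₂<c₃ : c₂ < c₃) where

  private
    contains : ∀ π → (∀ k → A (quadruple r₀ r₁ r₂ r₃ k) (quadruple c₀ c₁ c₂ c₃ (π k)) ≡ 1ℤ) →
               Contains A π
    contains π ones = quadruple r₀ r₁ r₂ r₃ , quadruple c₀ c₁ c₂ c₃
                    , quadruple-increasing r₀<r₁ r₁<r₂ r₂<r₃
                    , quadruple-increasing c₀<c₁ c₁<c₂ c₂<c₃ , ones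

  contains-2143 : A r₀ c₁ ≡ 1ℤ → A r₁ c₀ ≡ 1ℤ → A r₂ c₃ ≡ 1ℤ → A r₃ c₂ ≡ 1ℤ → Contains A p2143
  contains-2143 e₀ e₁ e₂ e₃ = contains p2143 λ { 0F → e₀ ; 1F → e₁ ; 2F → e₂ ; 3F → e₃ }

  contains-3412 : A r₀ c₂ ≡ 1ℤ → A r₁ c₃ ≡ 1ℤ → A r₂ c₀ ≡ 1ℤ → A r₃ c₁ ≡ 1ℤ → Contains A p3412
  contains-3412 e₀ e₁ e₂ e₃ = contains p3412 λ { 0F → e₀ ; 1F → e₁ ; 2F → e₂ ; 3F → e₃ }

predecessor-between : ∀ {n} {a i : Fin n} → a < i → Σ[ i₋ ∈ Fin n ] suc (toℕ i₋) ≡ toℕ i × a ≤ i₋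
predecessor-between {a = a} {i = fsuc i} a<i =
  inject₁ i , cong suc (toℕ-inject₁ i) , subst (toℕ a ℕ.≤_) (sym (toℕ-inject₁ i)) (ℕ.s≤s⁻¹ a<i)

successor-between : ∀ {n} {i b : Fin n} → i < b → Σ[ i₊ ∈ Fin n ] toℕ i₊ ≡ suc (toℕ i) × i₊ ≤ b
successor-between {n} {i} {b} i<b =
  fromℕ< i+1<n , i₊≡i+1 , subst (ℕ._≤ toℕ b) (sym i₊≡i+1) i<b
  where
  i+1<n : suc (toℕ i) ℕ.< n
  i+1<n = ℕ.≤-<-trans i<b (toℕ<n b)
  i₊≡i+1 : toℕ (fromℕ< i+1<n) ≡ suc (toℕ i)
  i₊≡i+1 = toℕ-fromℕ< i+1<n

zero-off-column : ∀ {n} {A : Matrix n} → IsASM A → ∀ {r d} → A r d ≡ 0ℤ →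
                  ∃[ x ] A r x ≡ 1ℤ × (x < d ⊎ d < x)
zero-off-column {A = A} asm {r} {d} Ard≡0 with walk-has-one (A r) (row-walk asm r)
... | x , Arx≡1 with <-cmp x d
... | tri< x<d _ _ = x , Arx≡1 , inj₁ x<d
... | tri≈ _ refl _ = case trans (sym Ard≡0) Arx≡1 of λ ()
... | tri> _ _ d<x = x , Arx≡1 , inj₂ d<x

module MiddleColumn {n} {A : Matrix n} (asm : IsASM A)
         (avoids-2143 : Avoids A p2143) (avoids-3412 : Avoids A p3412) {i c₁ d c₃ : Fin n}
         (c₁<d : c₁ < d) (d<c₃ : d < c₃) (Aic₁≡-1 : A i c₁ ≡ -1ℤ) (Aic₃≡-1 : A i c₃ ≡ -1ℤ) where

  private
    module X₁ = Cross (minus-one-cross asm Aic₁≡-1)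
    module X₃ = Cross (minus-one-cross asm Aic₃≡-1)

    distinct-rows : ∀ {a r} → a ≤ r → A a d ≢ A r d → a < r
    distinct-rows a≤r Aad≢Ard = ≤∧≢⇒< a≤r (Aad≢Ard ∘ cong (λ x → A x d))

  no-zero-above-middle : ∀ {a r} → a ≤ r → r < i → A a d ≡ 1ℤ → A r d ≢ 0ℤ
  no-zero-above-middle a≤r r<i Aad≡1 Ard≡0
    with zero-off-column asm Ard≡0 | distinct-rows a≤r (one≢zero Aad≡1 Ard≡0)
  ... | x , Arx≡1 , inj₁ x<d | a<r = avoids-2143
        (contains-2143 a<r r<i X₃.i<below x<d d<c₃ X₃.c<right Aad≡1 Arx≡1 X₃.A-right X₃.A-below)
  ... | x , Arx≡1 , inj₂ d<x | a<r = avoids-3412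
        (contains-3412 a<r r<i X₁.i<below X₁.left<c c₁<d d<x Aad≡1 Arx≡1 X₁.A-left X₁.A-below)

  no-zero-below-middle : ∀ {r b} → i < r → r ≤ b → A b d ≡ 1ℤ → A r d ≢ 0ℤ
  no-zero-below-middle i<r r≤b Abd≡1 Ard≡0
    with zero-off-column asm Ard≡0 | distinct-rows r≤b (≢-sym (one≢zero Abd≡1 Ard≡0))
  ... | x , Arx≡1 , inj₁ x<d | r<b = avoids-3412
        (contains-3412 X₃.above<i i<r r<b x<d d<c₃ X₃.c<right X₃.A-above X₃.A-right Arx≡1 Abd≡1)
  ... | x , Arx≡1 , inj₂ d<x | r<b = avoids-2143
        (contains-2143 X₁.above<i i<r r<b X₁.left<c c₁<d d<x X₁.A-above X₁.A-left Arx≡1 Abd≡1)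

lemma5p4 : (n : ℕ) (A : Matrix n) → InASM-2143-3412 A →
    (i c₁ d c₃ : Fin n) → c₁ < d → d < c₃ →
    A i c₁ ≡ -1ℤ → A i d ≡ -1ℤ → A i c₃ ≡ -1ℤ →
    (∀ r c → A r c ≡ -1ℤ → r ≡ i × (c ≡ c₁ ⊎ c ≡ d ⊎ c ≡ c₃)) →
    (∃[ i₋ ] (suc (toℕ i₋) ≡ toℕ i × A i₋ d ≡ 1ℤ))
    × (∃[ i₊ ] (toℕ i₊ ≡ suc (toℕ i) × A i₊ d ≡ 1ℤ))
lemma5p4 n A (asm , avoids-2143 , avoids-3412) i c₁ d c₃ c₁<d d<c₃ Aic₁≡-1 Aid≡-1 Aic₃≡-1 only-row-i =
  row-above , row-below
  where
  open MiddleColumn asm avoids-2143 avoids-3412 c₁<d d<c₃ Aic₁≡-1 Aic₃≡-1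
  open Cross (minus-one-cross asm Aid≡-1) using (above<i; A-above; i<below; A-below)

  one-off-row-i : ∀ r → r ≢ i → A r d ≢ 0ℤ → A r d ≡ 1ℤ
  one-off-row-i r r≢i Ard≢0 = trit-one (proj₁ asm r d) Ard≢0 (r≢i ∘ proj₁ ∘ only-row-i r d)

  row-above : ∃[ i₋ ] (suc (toℕ i₋) ≡ toℕ i × A i₋ d ≡ 1ℤ)
  row-above with predecessor-between above<i
  ... | i₋ , i₋+1≡i , above≤i₋ =
    i₋ , i₋+1≡i , one-off-row-i i₋ (<⇒≢ i₋<i) (no-zero-above-middle above≤i₋ i₋<i A-above)
    where
    i₋<i : i₋ < i
    i₋<i = ℕ.≤-reflexive i₋+1≡i

  row-below : ∃[ i₊ ] (toℕ i₊ ≡ suc (toℕ i) × A i₊ d ≡ 1ℤ)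
  row-below with successor-between i<below
  ... | i₊ , i₊≡i+1 , i₊≤below =
    i₊ , i₊≡i+1 , one-off-row-i i₊ (≢-sym (<⇒≢ i<i₊)) (no-zero-below-middle i<i₊ i₊≤below A-below)
    where
    i<i₊ : i < i₊
    i<i₊ = ℕ.≤-reflexive (sym i₊≡i+1)
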